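{- Let $k\ge1$, $L\ge0$, $n=4k\cdot2^L$, $F\in\{0,1\}^n$, $F'$ any binary string, $o\in\mathbb{N}$, $R$ a randomness table and $\ell\in\{0,\dots,L\}$. Assume that there is no $k$-bad self-matching of $F$ in level $\ell$ under $\mathrm{hash}_{R,o}$. Then a maximum-size level-$\ell$ monotone disjoint matching between $F$ and $F'$ under $\mathrm{hash}_{R,o}$ (the matching computed in level $\ell$ of the recovery algorithm when the level-$\ell$ hashes of $F$ are known correctly) contains at most $ED(F,F')+k$ pairs $(i_j,i'_j)$ with $F[i_j,i_j+2^{L-\ell}-1]\ne F'[i'_j,i'_j+2^{L-\ell}-1]$.
   Context: $R$ is a three-dimensional table of bits $R[p,\ell,i]$. For $o\in\mathbb{N}$, a bit string $S$, an offset $s\ge0$ and a level $\ell$, $\mathrm{hash}_{R,o}(S,s,\ell)$ is the $o$-bit string $h_1,\dots,h_o$ with $h_i=\bigoplus_{j=1}^{|S|}\big(S[j]\cdot R[s+j-1,\ell,i]\big)$, except that if $o>|S|$ it outputs $S$ padded with zeros to length $o$. $S[a,b]$ is the substring from position $a$ to $b$ inclusive. Let $b_\ell=2^{L-\ell}$. A level-$\ell$ size-$m$ matching between strings $A$ (with $|A|=n$) and $B$ under $\mathrm{hash}_{R,o}$ consists of indices $i_1\le\dots\le i_m$ in $[1,n-b_\ell+1]$ and $i'_1,\dots,i'_m$ in $[1,|B|-b_\ell+1]$ with each $i_j-1$ a multiple of $b_\ell$ and $\mathrm{hash}_{R,o}(A[i_j,i_j+b_\ell-1],i_j-1,\ell)=\mathrm{hash}_{R,o}(B[i'_j,i'_j+b_\ell-1],i_j-1,\ell)$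 for all $j$. It is monotone if $i'_1\le\dots\le i'_m$; disjoint if $|i'_j-i'_{j'}|\ge b_\ell$ for $j\ne j'$; bad if $A[i_j,i_j+b_\ell-1]\ne B[i'_j,i'_j+b_\ell-1]$ for every $j$. A $k$-bad self-matching of $F$ in level $\ell$ is a level-$\ell$ size-$k$ monotone, disjoint, bad matching between $F$ and $F$ itself. $ED$ denotes edit distance. -}

module Defs where

open import Data.Bool using (Bool; true; false; _∧_; _xor_)
open import Data.Nat using (ℕ; zero; suc; _+_; _*_; _∸_; _^_; _≤_; _<_; _<ᵇ_; ∣_-_∣)
open import Data.Nat.Divisibility using (_∣_)
open import Data.List using (List; []; _∷_; length; take; drop; map; upTo; zipWith; foldr; replicate; _++_; filter)
open import Data.List.Relation.Unary.All using (All)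
open import Data.List.Relation.Unary.AllPairs using (AllPairs)
open import Data.List.Properties using (≡-dec)
open import Data.Product using (_×_; _,_; proj₁; proj₂)
open import Relation.Binary.PropositionalEquality using (_≡_)
open import Relation.Nullary using (¬_)
open import Relation.Nullary.Decidable using (¬?)
import Data.Bool as B

BitString : Set
BitString = List Bool

-- Randomness table R[p, ℓ, i]  (all indices 0-based: position p = s + j - 1,
-- level ℓ, output bit index i - 1).
Table : Set
Table = ℕ → ℕ → ℕ → Bool

-- S[a+1, a+b] in 1-based notation: the length-b substring starting at 0-based a.
sub : BitString → ℕ → ℕ → BitString
sub S a b = take b (drop a S)

-- i-th output bit (0-based i) of hash_{R,o}(S, s, ℓ): ⊕_j S[j] · R[s+j-1, ℓ, i].
hashBit : Table → BitString → ℕ → ℕ → ℕ → Bool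
hashBit R S s ℓ i =
  foldr _xor_ false (zipWith _∧_ S (map (λ j → R (s + j) ℓ i) (upTo (length S))))

hash : Table → ℕ → BitString → ℕ → ℕ → BitString
hash R o S s ℓ with length S <ᵇ o
... | true  = S ++ replicate (o ∸ length S) false
... | false = map (hashBit R S s ℓ) (upTo o)

blockLen : ℕ → ℕ → ℕ
blockLen L ℓ = 2 ^ (L ∸ ℓ)

-- A matching is a list of pairs (i_j - 1, i'_j - 1) of 0-based start positions.
Pairs : Set
Pairs = List (ℕ × ℕ)

ValidPair : Table → ℕ → ℕ → ℕ → BitString → BitString → ℕ × ℕ → Set
ValidPair R o L ℓ A B (i , i') =
  (i + blockLen L ℓ ≤ length A) × (i' + blockLen L ℓ ≤ length B) ×
  (blockLen L ℓ ∣ i) ×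
  (hash R o (sub A i (blockLen L ℓ)) i ℓ ≡ hash R o (sub B i' (blockLen L ℓ)) i ℓ)

IsMatching : Table → ℕ → ℕ → ℕ → BitString → BitString → Pairs → Set
IsMatching R o L ℓ A B M =
  All (ValidPair R o L ℓ A B) M × AllPairs (λ p q → proj₁ p ≤ proj₁ q) M

Monotone : Pairs → Set
Monotone M = AllPairs (λ p q → proj₂ p ≤ proj₂ q) M

Disjoint : ℕ → ℕ → Pairs → Set
Disjoint L ℓ M = AllPairs (λ p q → blockLen L ℓ ≤ ∣ proj₂ p - proj₂ q ∣) M

Bad : ℕ → ℕ → BitString → BitString → Pairs → Set
Bad L ℓ A B M = All (λ p → ¬ (sub A (proj₁ p) (blockLen L ℓ) ≡ sub B (proj₂ p) (blockLen L ℓ))) M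

MonDisjMatching : Table → ℕ → ℕ → ℕ → BitString → BitString → Pairs → Set
MonDisjMatching R o L ℓ A B M = IsMatching R o L ℓ A B M × Monotone M × Disjoint L ℓ M

BadSelfMatching : Table → ℕ → ℕ → ℕ → ℕ → BitString → Pairs → Set
BadSelfMatching R o L ℓ k F M =
  length M ≡ k × MonDisjMatching R o L ℓ F F M × Bad L ℓ F F M

MaxMonDisjMatching : Table → ℕ → ℕ → ℕ → BitString → BitString → Pairs → Set
MaxMonDisjMatching R o L ℓ A B M =
  MonDisjMatching R o L ℓ A B M ×
  (∀ M' → MonDisjMatching R o L ℓ A B M' → length M' ≤ length M)

badCount : ℕ → ℕ → BitString → BitString → Pairs → ℕ
badCount L ℓ A B M =
  length (filter (λ p → ¬? (≡-dec B._≟_ (sub A (proj₁ p) (blockLen L ℓ)) (sub B (proj₂ p) (blockLen L ℓ)))) M)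

-- Edit scripts (insertions and deletions, unit cost): EditScript d X Y means
-- X can be turned into Y with d insertions/deletions.  ED(X,Y) is the least such d.
data EditScript : ℕ → BitString → BitString → Set where
  done : EditScript 0 [] []
  keep : ∀ {d X Y} x → EditScript d X Y → EditScript d (x ∷ X) (x ∷ Y)
  del  : ∀ {d X Y} x → EditScript d X Y → EditScript (suc d) (x ∷ X) Y
  ins  : ∀ {d X Y} y → EditScript d X Y → EditScript (suc d) X (y ∷ Y)

IsED : BitString → BitString → ℕ → Set
IsED X Y d = EditScript d X Y × (∀ d' → EditScript d' X Y → d ≤ d')

module Submission where

-- Fix an optimal edit script turning F into F′ and follow
-- it along the bad pairs (i , w) of the maximum matching M, which occupy
-- pairwise disjoint windows F′[w , w + b) in increasing order.  A window of F′
-- on which the script performs no edit is an exact copy of some window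
-- F[x , x + b); since the pair is bad, F[i , i + b) ≠ F[x , x + b) while both
-- have the hash of F′[w , w + b), so (i , x) is a bad pair of a self-matching
-- of F.  Every other window contains at least one of the ed edits.  Hence
--   badCount ≤ ed + (size of a bad self-matching of F),
-- and the self-matching found has fewer than k pairs, since any k of its pairs
-- would form a k-bad self-matching.

open import Defs
open import Data.Nat using (ℕ; zero; suc; _+_; _*_; _^_; _∸_; _≤_; _<_; z≤n; s≤s; ∣_-_∣)
open import Data.Nat.Properties
  using ( ≤-trans; <⇒≤; ≰⇒>; +-suc; +-monoˡ-≤; +-monoʳ-≤; m≤m+n; m≤n+m
        ; m+[n∸m]≡n; m+n∸m≡n; m≤n⇒∣m-n∣≡n∸m; ∸-monoˡ-≤; m≤n⇒m⊓n≡m; m^n>0 )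
open import Data.List using (List; []; _∷_; length; take; drop; _++_; filter)
open import Data.List.Properties using (length-take; drop-drop; take++drop≡id; ≡-dec)
open import Data.List.Relation.Unary.All as All using (All; []; _∷_)
import Data.List.Relation.Unary.All.Properties as All
open import Data.List.Relation.Unary.AllPairs as AllPairs using (AllPairs; []; _∷_)
import Data.List.Relation.Unary.AllPairs.Properties as AllPairs
open import Data.Product using (Σ; ∃; _×_; _,_; proj₁; proj₂; uncurry)
open import Relation.Binary.PropositionalEquality
  using (_≡_; refl; sym; trans; cong; subst; subst₂; module ≡-Reasoning)
open import Relation.Nullary using (¬_; ¬?; Dec)
import Data.Bool as Bool

take-length-++ : ∀ {A : Set} (xs ys : List A) → take (length xs) (xs ++ ys) ≡ xs
take-length-++ []       ys = refl
take-length-++ (x ∷ xs) ys = cong (x ∷_) (take-length-++ xs ys)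

drop-length-++ : ∀ {A : Set} (xs ys : List A) → drop (length xs) (xs ++ ys) ≡ ys
drop-length-++ []       ys = refl
drop-length-++ (x ∷ xs) ys = drop-length-++ xs ys

sub-length : ∀ x b (X : BitString) → x + b ≤ length X → length (sub X x b) ≡ b
sub-length zero    b X       x+b≤ = trans (length-take b X) (m≤n⇒m⊓n≡m x+b≤)
sub-length (suc x) b (_ ∷ X) (s≤s x+b≤) = sub-length x b X x+b≤

full-window : ∀ x b (X : BitString) → 0 < b → length (sub X x b) ≡ b → x + b ≤ length X
full-window zero    b X       _   eq = subst (_≤ length X) eq (length-take≤ b X)
  where
  length-take≤ : ∀ n (xs : BitString) → length (take n xs) ≤ length xs
  length-take≤ zero    xs       = z≤n
  length-take≤ (suc n) []       = z≤n
  length-take≤ (suc n) (_ ∷ xs) = s≤s (length-take≤ n xs)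
full-window (suc x) (suc b) []      _   ()
full-window (suc x) b       (_ ∷ X) 0<b eq = s≤s (full-window x b X 0<b eq)

exact-script : ∀ {X Y} → EditScript 0 X Y → X ≡ Y
exact-script done       = refl
exact-script (keep x e) = cong (x ∷_) (exact-script e)

record Split (d : ℕ) (X Y₁ Y₂ : BitString) : Set where
  constructor split
  field
    {X₁ X₂}    : BitString
    {d₁ d₂}    : ℕ
    source-eq  : X ≡ X₁ ++ X₂
    cost-eq    : d ≡ d₁ + d₂
    script₁    : EditScript d₁ X₁ Y₁
    script₂    : EditScript d₂ X₂ Y₂

split-target : ∀ Y₁ {d X Y₂} → EditScript d X (Y₁ ++ Y₂) → Split d X Y₁ Y₂
split-target []       e = split refl refl done e
split-target (y ∷ Y₁) (keep _ e) with split-target Y₁ e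
... | split p q e₁ e₂ = split (cong (y ∷_) p) q (keep y e₁) e₂
split-target (y ∷ Y₁) (del x e) with split-target (y ∷ Y₁) e
... | split p q e₁ e₂ = split (cong (x ∷_) p) (cong suc q) (del x e₁) e₂
split-target (y ∷ Y₁) (ins _ e) with split-target Y₁ e
... | split p q e₁ e₂ = split p (cong suc q) (ins y e₁) e₂

Separated : ℕ → ℕ × ℕ → ℕ × ℕ → Set
Separated b p q = proj₁ p ≤ proj₁ q × proj₂ p + b ≤ proj₂ q

module WindowTracing (X Y : BitString) (b : ℕ) (0<b : 0 < b) where

  Script : ℕ → ℕ → ℕ → Set
  Script d x y = EditScript d (drop x X) (drop y Y)

  record Cut (d x y m : ℕ) : Set where
    constructor cut
    field
      {segment}     : BitString
      {cost₁ cost₂} : ℕ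
      segment-at-x  : sub X x (length segment) ≡ segment
      cost-eq       : d ≡ cost₁ + cost₂
      head          : EditScript cost₁ segment (sub Y y m)
      rest          : Script cost₂ (x + length segment) (y + m)

  cut-target : ∀ m {d x y} → Script d x y → Cut d x y m
  cut-target m {d} {x} {y} e
    with split-target (sub Y y m)
           (subst (EditScript d (drop x X)) (sym (take++drop≡id m (drop y Y))) e)
  ... | split {X₁} {X₂} X≡ d≡ e₁ e₂ = cut prefix d≡ e₁ rest
    where
    open ≡-Reasoning
    prefix : sub X x (length X₁) ≡ X₁
    prefix = trans (cong (take (length X₁)) X≡) (take-length-++ X₁ X₂)
    suffix : drop (x + length X₁) X ≡ X₂
    suffix = begin
      drop (x + length X₁) X        ≡⟨ sym (drop-drop x (length X₁) X) ⟩
      drop (length X₁) (drop x X)   ≡⟨ cong (drop (length X₁)) X≡ ⟩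
      drop (length X₁) (X₁ ++ X₂)   ≡⟨ drop-length-++ X₁ X₂ ⟩
      X₂                            ∎
    rest : Script _ (x + length X₁) (y + m)
    rest = subst₂ (EditScript _) (sym suffix) (drop-drop y m Y) e₂

  data WindowFate (d x w : ℕ) : Set where
    copied : ∀ x′ {d′} → x ≤ x′ → x′ + b ≤ length X → sub X x′ b ≡ sub Y w b →
             d′ ≤ d → Script d′ (x′ + b) (w + b) → WindowFate d x w
    edited : ∀ x′ {d′} → x ≤ x′ → suc d′ ≤ d → Script d′ x′ (w + b) → WindowFate d x w

  window-fate : ∀ {d x y} w → y ≤ w → w + b ≤ length Y → Script d x y → WindowFate d x w
  window-fate {d} {x} {y} w y≤w w+b≤ e
    with cut-target (w ∸ y) {d} {x} {y} e
  ... | cut {S} {c₁} {c₂} _ d≡ _ e′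
    with cut-target b {c₂} {x + length S} {w} (subst (Script c₂ (x + length S)) (m+[n∸m]≡n y≤w) e′)
  ... | cut {T} {zero} {c₄} T-at c≡ e₀ e″ =
    copied x₁ (m≤m+n x (length S)) fits copy c₄≤d
      (subst (λ z → Script c₄ (x₁ + z) (w + b)) T-length e″)
    where
    x₁ : ℕ
    x₁ = x + length S
    T≡ : T ≡ sub Y w b
    T≡ = exact-script e₀
    T-length : length T ≡ b
    T-length = trans (cong length T≡) (sub-length w b Y w+b≤)
    copy : sub X x₁ b ≡ sub Y w b
    copy = trans (subst (λ z → sub X x₁ z ≡ T) T-length T-at) T≡
    fits : x₁ + b ≤ length X
    fits = full-window x₁ b X 0<b (trans (cong length copy) (sub-length w b Y w+b≤))
    c₄≤d : c₄ ≤ d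
    c₄≤d rewrite d≡ | c≡ = m≤n+m c₄ c₁
  ... | cut {T} {suc c₃} {c₄} _ c≡ _ e″ =
    edited (x + length S + length T) (≤-trans (m≤m+n x _) (m≤m+n _ (length T))) c₄<d e″
    where
    c₄<d : suc c₄ ≤ d
    c₄<d rewrite d≡ | c≡ = ≤-trans (s≤s (m≤n+m c₄ c₃)) (m≤n+m _ c₁)

  WindowOfY : (ℕ × ℕ → Set) → ℕ → ℕ × ℕ → Set
  WindowOfY Q y (i , w) = Q (i , w) × y ≤ w × w + b ≤ length Y

  CopyInX : (ℕ × ℕ → Set) → ℕ → ℕ × ℕ → Set
  CopyInX Q x (i , x′) =
    Σ ℕ λ w → Q (i , w) × x ≤ x′ × x′ + b ≤ length X × sub X x′ b ≡ sub Y w b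

  private
    copy-mono : ∀ {Q Q′ : ℕ × ℕ → Set} {x x₁} → (∀ {p} → Q′ p → Q p) → x ≤ x₁ →
                ∀ {q} → CopyInX Q′ x₁ q → CopyInX Q x q
    copy-mono Q′⇒Q x≤x₁ (w , Q′w , x₁≤ , fits , copy) = w , Q′⇒Q Q′w , ≤-trans x≤x₁ x₁≤ , fits , copy

    count-copied : ∀ {m c d d′} → m ≤ d′ + c → d′ ≤ d → suc m ≤ d + suc c
    count-copied {m} {c} {d} m≤ d′≤d rewrite +-suc d c = s≤s (≤-trans m≤ (+-monoˡ-≤ c d′≤d))

    count-edited : ∀ {m c d d′} → m ≤ d′ + c → suc d′ ≤ d → suc m ≤ d + c
    count-edited {c = c} m≤ d′<d = ≤-trans (s≤s m≤) (+-monoˡ-≤ c d′<d)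

  record Traced (Q : ℕ × ℕ → Set) (x : ℕ) (W : Pairs) (d : ℕ) : Set where
    constructor traced
    field
      copies    : Pairs
      count     : length W ≤ d + length copies
      copies-ok : All (CopyInX Q x) copies
      separated : AllPairs (Separated b) copies

  -- The order of
  -- the first components is kept by strengthening Q to "not before the head".
  trace-windows : (Q : ℕ × ℕ → Set) (W : Pairs) {d x y : ℕ} → Script d x y →
                  All (WindowOfY Q y) W → AllPairs (Separated b) W → Traced Q x W d
  trace-windows Q [] e _ _ = traced [] z≤n [] []
  trace-windows Q ((i , w) ∷ W) e ((Qiw , y≤w , w+b≤) ∷ inside) (later ∷ sep)
    with window-fate w y≤w w+b≤ e
  ... | copied x′ x≤x′ fits copy d′≤d e′ =
    traced ((i , x′) ∷ copies) (count-copied count d′≤d)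
      ((w , Qiw , x≤x′ , fits , copy) ∷ All.map (copy-mono {Q} {Q′} proj₁ x≤x′+b) copies-ok)
      (All.map head-first copies-ok ∷ separated)
    where
    Q′ : ℕ × ℕ → Set
    Q′ q = Q q × i ≤ proj₁ q
    inside′ : All (WindowOfY Q′ (w + b)) W
    inside′ = All.zipWith (λ { ((Qq , _ , fits′) , (i≤ , w+b≤′)) → (Qq , i≤) , w+b≤′ , fits′ })
                (inside , later)
    open Traced (trace-windows Q′ W {x = x′ + b} e′ inside′ sep)
    x≤x′+b : _ ≤ x′ + b
    x≤x′+b = ≤-trans x≤x′ (m≤m+n x′ b)
    head-first : ∀ {q} → CopyInX Q′ (x′ + b) q → Separated b (i , x′) q
    head-first (_ , (_ , i≤) , x′+b≤ , _) = i≤ , x′+b≤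
  ... | edited x′ x≤x′ d′<d e′ =
    traced copies (count-edited count d′<d)
      (All.map (copy-mono {Q} {Q} (λ Qq → Qq) x≤x′) copies-ok) separated
    where
    inside′ : All (WindowOfY Q (w + b)) W
    inside′ = All.zipWith (λ { ((Qq , _ , fits′) , (_ , w+b≤′)) → Qq , w+b≤′ , fits′ })
                (inside , later)
    open Traced (trace-windows Q W {x = x′} e′ inside′ sep)

apart⇒before : ∀ {a c} b → a ≤ c → b ≤ ∣ a - c ∣ → a + b ≤ c
apart⇒before {a} {c} b a≤c b≤ =
  subst (a + b ≤_) (m+[n∸m]≡n a≤c) (+-monoʳ-≤ a (subst (b ≤_) (m≤n⇒∣m-n∣≡n∸m a≤c) b≤))

before⇒apart : ∀ {a c} b → a + b ≤ c → b ≤ ∣ a - c ∣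
before⇒apart {a} {c} b a+b≤c =
  subst₂ _≤_ (m+n∸m≡n a b) (sym (m≤n⇒∣m-n∣≡n∸m (≤-trans (m≤m+n a b) a+b≤c)))
    (∸-monoˡ-≤ a a+b≤c)

separated-if-monotone-disjoint : ∀ L ℓ {M : Pairs} → AllPairs (λ p q → proj₁ p ≤ proj₁ q) M →
  Monotone M → Disjoint L ℓ M → AllPairs (Separated (blockLen L ℓ)) M
separated-if-monotone-disjoint L ℓ ordered mon disj =
  AllPairs.zipWith (λ { (i≤i′ , w≤w′ , apart) → i≤i′ , apart⇒before (blockLen L ℓ) w≤w′ apart })
    (ordered , AllPairs.zipWith (λ x → x) (mon , disj))

bad-prefix : ∀ (R : Table) o L ℓ k (F : BitString) {M : Pairs} → k ≤ length M →
  MonDisjMatching R o L ℓ F F M → Bad L ℓ F F M → BadSelfMatching R o L ℓ k F (take k M)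
bad-prefix R o L ℓ k F {M} k≤ ((valid , ordered) , mon , disj) bad =
  trans (length-take k M) (m≤n⇒m⊓n≡m k≤) ,
  ((All.take⁺ k valid , AllPairs.take⁺ k ordered) , AllPairs.take⁺ k mon , AllPairs.take⁺ k disj) ,
  All.take⁺ k bad

module BadCopies (R : Table) (o L ℓ : ℕ) (F F′ : BitString) where

  b : ℕ
  b = blockLen L ℓ

  open WindowTracing F F′ b (m^n>0 2 (L ∸ ℓ)) public

  BadPair : ℕ × ℕ → Set
  BadPair (i , w) = ValidPair R o L ℓ F F′ (i , w) × ¬ (sub F i b ≡ sub F′ w b)

  copies-self-match : ∀ {C} → All (CopyInX BadPair 0) C → AllPairs (Separated b) C →
    MonDisjMatching R o L ℓ F F C × Bad L ℓ F F C
  copies-self-match copies separated =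
    ((All.map valid copies , AllPairs.map proj₁ separated) ,
     AllPairs.map (λ { {_ , x} (_ , x+b≤) → ≤-trans (m≤m+n x b) x+b≤ }) separated ,
     AllPairs.map (λ { (_ , x+b≤) → before⇒apart b x+b≤ }) separated) ,
    All.map (λ { (_ , (_ , unequal) , _ , _ , copy) same → unequal (trans same copy) }) copies
    where
    -- hash(F[i..]) = hash(F′[w..]) = hash(F[x..]) since F[x..] is a copy of F′[w..].
    valid : ∀ {q} → CopyInX BadPair 0 q → ValidPair R o L ℓ F F q
    valid {i , x} (w , ((i+b≤ , _ , b∣i , hash≡) , _) , _ , x+b≤ , copy) =
      i+b≤ , x+b≤ , b∣i , trans hash≡ (cong (λ S → hash R o S i ℓ) (sym copy))

lemma2 : (k L n : ℕ) → 1 ≤ k → n ≡ 4 * k * 2 ^ L →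
    (F F' : BitString) → length F ≡ n →
    (o : ℕ) (R : Table) (ℓ : ℕ) → ℓ ≤ L →
    ¬ (∃ λ M → BadSelfMatching R o L ℓ k F M) →
    (M : Pairs) → MaxMonDisjMatching R o L ℓ F F' M →
    (ed : ℕ) → IsED F F' ed →
    badCount L ℓ F F' M ≤ ed + k
lemma2 k L _ _ _ F F′ _ o R ℓ _ no-bad-self-matching M (((valid , ordered) , mon , disj) , _)
       ed (script , _) =
  ≤-trans count (+-monoʳ-≤ ed (<⇒≤ few-copies))
  where
  open BadCopies R o L ℓ F F′
  bad? : (p : ℕ × ℕ) → Dec (¬ (sub F (proj₁ p) b ≡ sub F′ (proj₂ p) b))
  bad? p = ¬? (≡-dec Bool._≟_ (sub F (proj₁ p) b) (sub F′ (proj₂ p) b))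
  bad-windows : All (WindowOfY BadPair 0) (filter bad? M)
  bad-windows = All.zipWith (λ { (v , unequal) → (v , unequal) , z≤n , proj₁ (proj₂ v) })
                  (All.filter⁺ bad? valid , All.all-filter bad? M)
  open Traced (trace-windows BadPair (filter bad? M) {x = 0} script bad-windows
                 (AllPairs.filter⁺ bad? (separated-if-monotone-disjoint L ℓ ordered mon disj)))
  -- Any k of the copies would form a k-bad self-matching of F.
  few-copies : length copies < k
  few-copies = ≰⇒> λ k≤ → no-bad-self-matching
    (take k copies , uncurry (bad-prefix R o L ℓ k F k≤) (copies-self-match copies-ok separated))
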